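{- Let $A$ and $B$ be paratopic symmetric Latin squares of order $n$. Then $A$ and $B$ are isotopic. Moreover, if $A$ and $B$ are not rrs-isotopic, then $n$ is even and $A,B\in\Omega_n$.
   Context: A Latin square of order $n$ is a set of $n^2$ triples (row, column, symbol) over $\{1,\dots,n\}$, distinct triples agreeing in at most one coordinate; it is symmetric if it equals its transpose. An isotopism $(\alpha,\beta,\gamma)\in\mathcal{S}_n^3$ maps $(r,c,s)$ to $(r^\alpha,c^\beta,s^\gamma)$; it is an rrs-isotopism if $\alpha=\beta$. A paratopism is an isotopism combined with a uniform permutation of the three coordinates of all triples. An autotopism of $L$ is an isotopism mapping $L$ to itself; $\varepsilon$ denotes the identity permutation. A permutation $\theta\in\mathcal{S}_n$ is semiregular of prime order if it has no fixed points and all its cycles have the same prime length. $\Omega_n$ denotes the set of symmetric Latin squares of order $n$ possessing an autotopism $(\theta,\theta^{ -1},\varepsilon)$ with $\theta$ semiregular of prime order. -}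

module Defs where

open import Data.Nat using (ℕ; zero; suc; _<_)
open import Data.Nat.Primality using (Prime)
open import Data.Fin using (Fin) renaming (zero to f0; suc to fs)
open import Data.Fin.Permutation using (Permutation′; _⟨$⟩ʳ_; _⟨$⟩ˡ_; flip)
open import Data.Product using (_×_; _,_; Σ; ∃; ∃-syntax)
open import Function.Bundles using (_⇔_)
open import Relation.Binary.PropositionalEquality using (_≡_; _≢_)
open import Function.Base using (_∘_)

-- Every row and every column is injective; this is exactly the set of n²
-- triples {(r, c, L r c)} in which distinct triples agree in ≤ 1 coordinate.
record LatinSquare (n : ℕ) : Set where
  field
    cell    : Fin n → Fin n → Fin n
    row-inj : ∀ r {c c′} → cell r c ≡ cell r c′ → c ≡ c′
    col-inj : ∀ c {r r′} → cell r c ≡ cell r′ c → r ≡ r′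
open LatinSquare public

Triple : ℕ → Set
Triple n = Fin n × Fin n × Fin n

_∈L_ : ∀ {n} → Triple n → LatinSquare n → Set
(r , c , s) ∈L L = cell L r c ≡ s

-- f maps L onto L′ (f is always a bijection of triples below, so this says f(L) = L′)
MapsTo : ∀ {n} → (Triple n → Triple n) → LatinSquare n → LatinSquare n → Set
MapsTo f L L′ = ∀ t → (t ∈L L) ⇔ (f t ∈L L′)

Symmetric : ∀ {n} → LatinSquare n → Set
Symmetric L = ∀ r c → cell L r c ≡ cell L c r

iso : ∀ {n} → Permutation′ n → Permutation′ n → Permutation′ n → Triple n → Triple n
iso α β γ (r , c , s) = (α ⟨$⟩ʳ r , β ⟨$⟩ʳ c , γ ⟨$⟩ʳ s)

-- uniform permutation of the three coordinates, by σ ∈ S₃: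
-- the coordinate in position i moves to position σ(i).
coord : ∀ {n} → Triple n → Fin 3 → Fin n
coord (r , c , s) f0 = r
coord (r , c , s) (fs f0) = c
coord (r , c , s) (fs (fs f0)) = s

permute : ∀ {n} → Permutation′ 3 → Triple n → Triple n
permute σ t = ( coord t (σ ⟨$⟩ˡ f0) , coord t (σ ⟨$⟩ˡ fs f0) , coord t (σ ⟨$⟩ˡ fs (fs f0)) )

Isotopic : ∀ {n} → LatinSquare n → LatinSquare n → Set
Isotopic {n} A B = ∃[ α ] ∃[ β ] ∃[ γ ] MapsTo (iso {n} α β γ) A B

RrsIsotopic : ∀ {n} → LatinSquare n → LatinSquare n → Set
RrsIsotopic {n} A B = ∃[ α ] ∃[ γ ] MapsTo (iso {n} α α γ) A B

Paratopic : ∀ {n} → LatinSquare n → LatinSquare n → Set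
Paratopic {n} A B = ∃[ σ ] ∃[ α ] ∃[ β ] ∃[ γ ] MapsTo (permute σ ∘ iso {n} α β γ) A B

_^[_]_ : ∀ {n} → Permutation′ n → ℕ → Fin n → Fin n
θ ^[ zero ] x = x
θ ^[ suc k ] x = θ ⟨$⟩ʳ (θ ^[ k ] x)

-- θ is semiregular of prime order: no fixed points and every cycle has
-- the same prime length p (the cycle through x has length p iff θ^p x = x
-- and θ^k x ≠ x for 0 < k < p).
SemiregularPrime : ∀ {n} → Permutation′ n → Set
SemiregularPrime {n} θ =
  (∀ x → θ ⟨$⟩ʳ x ≢ x) ×
  ∃[ p ] (Prime p × (∀ x → θ ^[ p ] x ≡ x) × (∀ x k → 0 < k → k < p → θ ^[ k ] x ≢ x))

IsAutotopism : ∀ {n} → Permutation′ n → Permutation′ n → Permutation′ n → LatinSquare n → Set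
IsAutotopism α β γ L = MapsTo (iso α β γ) L L

Ω : ∀ {n} → LatinSquare n → Set
Ω {n} L = Symmetric L ×
  ∃[ θ ] (SemiregularPrime {n} θ × IsAutotopism θ (flip θ) Data.Fin.Permutation.id L)

-- Transposing a symmetric Latin square changes nothing, so a paratopism between symmetric
-- squares either keeps the symbols in the symbol position, and is then an isotopism up to
-- transposition, or exchanges them with rows or columns; symmetry of both squares turns the
-- latter into an rrs-isotopism.  Comparing an isotopism (α, β, γ) with its transpose
-- (β, α, γ) gives δ = β⁻¹α with A(δr, c) = A(r, δc), and a power of δ fixing one point fixes
-- every point.  If δ has odd order 2i + 1 then αδⁱ serves as both row and column permutation
-- of an rrs-isotopism; otherwise some power of δ is a fixed-point-free involution, which
-- forces n to be even and puts A in Ωₙ.  The same applies to B through the inverse isotopism.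
module Submission where

open import Defs
open import Data.Nat using (ℕ; zero; suc; _+_; _*_; _<_; z<s; s<s)
open import Data.Nat.Properties using (+-suc; +-comm; n<1+n; m<m+n; +-identityʳ; *-comm; m≤n⇒∃[o]m+o≡n; +-0-commutativeMonoid)
open import Data.Nat.Divisibility using (_∣_; divides)
open import Data.Nat.Induction using (<-rec)
open import Data.Nat.Primality using (prime[2])
open import Data.Bool using (if_then_else_)
open import Data.Product using (_×_; _,_; ∃-syntax)
open import Data.Sum as Sum using (_⊎_; inj₁; inj₂)
open import Data.Fin using (Fin; zero; suc; toℕ)
open import Data.Fin.Properties using (pigeonhole; all?; <-cmp) renaming (_≟_ to _≟ᶠ_; _<?_ to _<ᶠ?_)
open import Data.Fin.Permutation using (Permutation′; _⟨$⟩ʳ_; _⟨$⟩ˡ_; _∘ₚ_; flip; inverseʳ)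
import Data.Fin.Permutation as Perm
open import Function.Base using (_∘_)
open import Function.Bundles using (Injection; Equivalence; mk⇔)
open import Function.Properties.Inverse using (↔⇒↣)
open import Relation.Binary.Definitions using (tri<; tri≈; tri>)
open import Relation.Binary.PropositionalEquality
open import Relation.Nullary using (¬_; yes; no; does; contradiction)
open import Relation.Nullary.Decidable using (dec-true; dec-false)
open import Algebra.Properties.CommutativeMonoid.Sum +-0-commutativeMonoid using (sum; sum-permute; ∑-distrib-+; sum-cong-≗)

open ≡-Reasoning

private variable
  n : ℕ
  θ π α β γ : Permutation′ n
  A B L : LatinSquare n

⟨$⟩ʳ-injective : (π : Permutation′ n) {x y : Fin n} → π ⟨$⟩ʳ x ≡ π ⟨$⟩ʳ y → x ≡ y
⟨$⟩ʳ-injective π = Injection.injective (↔⇒↣ π)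

infixl 10 _^ₚ_

_^ₚ_ : Permutation′ n → ℕ → Permutation′ n
θ ^ₚ zero  = Perm.id
θ ^ₚ suc k = θ ^ₚ k ∘ₚ θ

^ₚ-+ : (θ : Permutation′ n) (a b : ℕ) (x : Fin n) →
       θ ^ₚ (a + b) ⟨$⟩ʳ x ≡ θ ^ₚ a ⟨$⟩ʳ (θ ^ₚ b ⟨$⟩ʳ x)
^ₚ-+ θ zero    b x = refl
^ₚ-+ θ (suc a) b x = cong (θ ⟨$⟩ʳ_) (^ₚ-+ θ a b x)

^ₚ-suc′ : (θ : Permutation′ n) (k : ℕ) (x : Fin n) → θ ^ₚ suc k ⟨$⟩ʳ x ≡ θ ^ₚ k ⟨$⟩ʳ (θ ⟨$⟩ʳ x)
^ₚ-suc′ θ k x = trans (cong (λ m → θ ^ₚ m ⟨$⟩ʳ x) (+-comm 1 k)) (^ₚ-+ θ k 1 x)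

^ₚ-returns : (θ : Permutation′ n) (x : Fin n) → ∃[ k ] θ ^ₚ suc k ⟨$⟩ʳ x ≡ x
^ₚ-returns {n} θ x
  with i , j , i<j , θⁱx≡θʲx ← pigeonhole (n<1+n n) (λ i → θ ^ₚ toℕ i ⟨$⟩ʳ x)
  with k , 1+i+k≡j ← m≤n⇒∃[o]m+o≡n i<j
  = k , ⟨$⟩ʳ-injective (θ ^ₚ toℕ i) (begin
      θ ^ₚ toℕ i ⟨$⟩ʳ (θ ^ₚ suc k ⟨$⟩ʳ x) ≡⟨ ^ₚ-+ θ (toℕ i) (suc k) x ⟨
      θ ^ₚ (toℕ i + suc k) ⟨$⟩ʳ x         ≡⟨ cong (λ m → θ ^ₚ m ⟨$⟩ʳ x) (trans (+-suc (toℕ i) k) 1+i+k≡j) ⟩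
      θ ^ₚ toℕ j ⟨$⟩ʳ x                   ≡⟨ θⁱx≡θʲx ⟨
      θ ^ₚ toℕ i ⟨$⟩ʳ x                   ∎)

IsIdentity : Permutation′ n → Set
IsIdentity π = ∀ x → π ⟨$⟩ʳ x ≡ x

FixedPointFree : Permutation′ n → Set
FixedPointFree π = ∀ x → π ⟨$⟩ʳ x ≢ x

IsInvolution : Permutation′ n → Set
IsInvolution π = ∀ x → π ⟨$⟩ʳ (π ⟨$⟩ʳ x) ≡ x

-- Equivalently, all cycles of θ have the same length.
Semiregular : Permutation′ n → Set
Semiregular θ = ∀ k x → θ ^ₚ k ⟨$⟩ʳ x ≡ x → IsIdentity (θ ^ₚ k)

even-or-odd : ∀ k → (∃[ j ] k ≡ j + j) ⊎ (∃[ j ] k ≡ suc (j + j))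
even-or-odd zero = inj₁ (0 , refl)
even-or-odd (suc k) with even-or-odd k
... | inj₁ (j , refl) = inj₂ (j , refl)
... | inj₂ (j , refl) = inj₁ (suc j , cong suc (sym (+-suc j j)))

semiregular⇒periodic : Semiregular θ → ∃[ k ] IsIdentity (θ ^ₚ suc k)
semiregular⇒periodic {zero}          _           = 0 , λ ()
semiregular⇒periodic {suc _} {θ = θ} semiregular =
  let k , θᵏ⁺¹0≡0 = ^ₚ-returns θ zero in k , semiregular (suc k) zero θᵏ⁺¹0≡0

module _ (semiregular : Semiregular θ) where

  semiregular-odd⊎involution : (∃[ i ] IsIdentity (θ ^ₚ suc (i + i))) ⊎
                               (∃[ j ] FixedPointFree (θ ^ₚ j) × IsInvolution (θ ^ₚ j))
  semiregular-odd⊎involution = let k , θᵏ⁺¹≡id = semiregular⇒periodic semiregular in halve (suc k) z<s θᵏ⁺¹≡id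
    where
    Goal : ℕ → Set
    Goal k = 0 < k → IsIdentity (θ ^ₚ k) → (∃[ i ] IsIdentity (θ ^ₚ suc (i + i))) ⊎
                                           (∃[ j ] FixedPointFree (θ ^ₚ j) × IsInvolution (θ ^ₚ j))
    -- An even period 2j halves to j unless θʲ ≠ id, and then θʲ is fixed-point free.
    step : ∀ k → (∀ {m} → m < k → Goal m) → Goal k
    step k recurse _ θᵏ≡id with even-or-odd k
    ... | inj₂ (i , refl) = inj₁ (i , θᵏ≡id)
    step _ _ () _ | inj₁ (zero , refl)
    step _ recurse _ θᵏ≡id | inj₁ (suc j , refl) with all? (λ x → θ ^ₚ suc j ⟨$⟩ʳ x ≟ᶠ x)
    ... | yes θʲ≡id = recurse (m<m+n (suc j) z<s) z<s θʲ≡id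
    ... | no  θʲ≢id = inj₂ (suc j , (λ x θʲx≡x → θʲ≢id (semiregular (suc j) x θʲx≡x)) ,
                                    λ x → trans (sym (^ₚ-+ θ (suc j) (suc j) x)) (θᵏ≡id x))

    halve : ∀ k → Goal k
    halve = <-rec Goal step

lessIndicator : Fin n → Fin n → ℕ
lessIndicator x y = if does (x <ᶠ? y) then 1 else 0

lessIndicator-+ : {x y : Fin n} → x ≢ y → lessIndicator x y + lessIndicator y x ≡ 1
lessIndicator-+ {x = x} {y} x≢y with <-cmp x y
... | tri< x<y _ y≮x rewrite dec-true (x <ᶠ? y) x<y | dec-false (y <ᶠ? x) y≮x = refl
... | tri≈ _ x≡y _ = contradiction x≡y x≢y
... | tri> x≮y _ y<x rewrite dec-false (x <ᶠ? y) x≮y | dec-true (y <ᶠ? x) y<x = refl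

sum-ones : ∀ n → sum {n} (λ _ → 1) ≡ n
sum-ones zero    = refl
sum-ones (suc n) = cong suc (sum-ones n)

-- Count each 2-cycle {x, πx} once, at its smaller point.
fixedPointFreeInvolution⇒even : (π : Permutation′ n) → FixedPointFree π → IsInvolution π → 2 ∣ n
fixedPointFreeInvolution⇒even {n} π fixedPointFree involution = divides (sum below) (begin
  n                                            ≡⟨ sum-ones n ⟨
  sum {n} (λ _ → 1)                            ≡⟨ sum-cong-≗ pairs ⟨
  sum (λ x → below x + below (π ⟨$⟩ʳ x))      ≡⟨ ∑-distrib-+ below (below ∘ (π ⟨$⟩ʳ_)) ⟩
  sum below + sum (below ∘ (π ⟨$⟩ʳ_))         ≡⟨ cong (sum below +_) (sum-permute below π) ⟨
  sum below + sum below                        ≡⟨ cong (sum below +_) (+-identityʳ (sum below)) ⟨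
  2 * sum below                                ≡⟨ *-comm 2 (sum below) ⟩
  sum below * 2                                ∎)
  where
  below : Fin n → ℕ
  below x = lessIndicator x (π ⟨$⟩ʳ x)

  pairs : ∀ x → below x + below (π ⟨$⟩ʳ x) ≡ 1
  pairs x rewrite involution x = lessIndicator-+ (fixedPointFree x ∘ sym)

fixedPointFreeInvolution⇒SemiregularPrime : FixedPointFree π → IsInvolution π → SemiregularPrime π
fixedPointFreeInvolution⇒SemiregularPrime {π = π} fixedPointFree involution =
  fixedPointFree , 2 , prime[2] , involution , noShorterCycle
  where
  noShorterCycle : ∀ x k → 0 < k → k < 2 → π ^[ k ] x ≢ x
  noShorterCycle x (suc zero)    _ _                 = fixedPointFree x
  noShorterCycle x (suc (suc k)) _ (s<s (s<s ()))

record Isotopism (α β γ : Permutation′ n) (A B : LatinSquare n) : Set where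
  constructor mkIsotopism
  field
    cell≡ : ∀ r c → cell B (α ⟨$⟩ʳ r) (β ⟨$⟩ʳ c) ≡ γ ⟨$⟩ʳ cell A r c
open Isotopism

MapsTo⇒Isotopism : MapsTo (iso α β γ) A B → Isotopism α β γ A B
MapsTo⇒Isotopism {A = A} maps = mkIsotopism λ r c → Equivalence.to (maps (r , c , cell A r c)) refl

Isotopism⇒MapsTo : Isotopism α β γ A B → MapsTo (iso α β γ) A B
Isotopism⇒MapsTo {γ = γ} isotopism (r , c , s) =
  mk⇔ (λ Arc≡s → trans (cell≡ isotopism r c) (cong (γ ⟨$⟩ʳ_) Arc≡s))
      (λ B≡γs → ⟨$⟩ʳ-injective γ (trans (sym (cell≡ isotopism r c)) B≡γs))

Isotopism-flip : Isotopism α β γ A B → Isotopism (flip α) (flip β) (flip γ) B A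
Isotopism-flip {α = α} {β} {γ} {A} {B} isotopism = mkIsotopism λ r c → ⟨$⟩ʳ-injective γ (begin
  γ ⟨$⟩ʳ cell A (α ⟨$⟩ˡ r) (β ⟨$⟩ˡ c)               ≡⟨ cell≡ isotopism _ _ ⟨
  cell B (α ⟨$⟩ʳ (α ⟨$⟩ˡ r)) (β ⟨$⟩ʳ (β ⟨$⟩ˡ c))   ≡⟨ cong₂ (cell B) (inverseʳ α) (inverseʳ β) ⟩
  cell B r c                                         ≡⟨ inverseʳ γ ⟨
  γ ⟨$⟩ʳ (γ ⟨$⟩ˡ cell B r c)                         ∎)

RrsIsotopic-sym : RrsIsotopic A B → RrsIsotopic B A
RrsIsotopic-sym {A = A} {B} (α , γ , maps) = flip α , flip γ , Isotopism⇒MapsTo (Isotopism-flip isotopism)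
  where
  isotopism : Isotopism α α γ A B
  isotopism = MapsTo⇒Isotopism maps

-- (θ, θ⁻¹, ε) is an autotopism of L, in a form that iterates without inverses.
record RowColumnShift (f : Fin n → Fin n) (L : LatinSquare n) : Set where
  constructor mkRowColumnShift
  field
    shift : ∀ r c → cell L (f r) c ≡ cell L r (f c)
open RowColumnShift

RowColumnShift-^ₚ : RowColumnShift (θ ⟨$⟩ʳ_) L → ∀ k → RowColumnShift (θ ^ₚ k ⟨$⟩ʳ_) L
RowColumnShift-^ₚ             θ-shift zero    = mkRowColumnShift λ r c → refl
RowColumnShift-^ₚ {θ = θ} {L} θ-shift (suc k) = mkRowColumnShift λ r c → begin
  cell L (θ ⟨$⟩ʳ (θ ^ₚ k ⟨$⟩ʳ r)) c   ≡⟨ shift θ-shift _ c ⟩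
  cell L (θ ^ₚ k ⟨$⟩ʳ r) (θ ⟨$⟩ʳ c)   ≡⟨ shift (RowColumnShift-^ₚ θ-shift k) r _ ⟩
  cell L r (θ ^ₚ k ⟨$⟩ʳ (θ ⟨$⟩ʳ c))   ≡⟨ cong (cell L r) (^ₚ-suc′ θ k c) ⟨
  cell L r (θ ^ₚ suc k ⟨$⟩ʳ c)         ∎

RowColumnShift-fixedPoint⇒≗id : {f : Fin n → Fin n} → RowColumnShift f L → ∀ {x} → f x ≡ x → ∀ y → f y ≡ y
RowColumnShift-fixedPoint⇒≗id {L = L} f-shift {x} fx≡x y =
  row-inj L x (trans (sym (shift f-shift x y)) (cong (λ r → cell L r y) fx≡x))

RowColumnShift⇒IsAutotopism : RowColumnShift (θ ⟨$⟩ʳ_) L → IsAutotopism θ (flip θ) Perm.id L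
RowColumnShift⇒IsAutotopism {θ = θ} {L} θ-shift = Isotopism⇒MapsTo autotopism
  where
  autotopism : Isotopism θ (flip θ) Perm.id L L
  autotopism = mkIsotopism λ r c → trans (shift θ-shift r (θ ⟨$⟩ˡ c)) (cong (cell L r) (inverseʳ θ))

module SymmetricIsotopism (symA : Symmetric A) (symB : Symmetric B) (isotopism : Isotopism α β γ A B) where

  δ : Permutation′ _
  δ = α ∘ₚ flip β

  β∘δ≗α : ∀ x → β ⟨$⟩ʳ (δ ⟨$⟩ʳ x) ≡ α ⟨$⟩ʳ x
  β∘δ≗α x = inverseʳ β

  -- compare the isotopism (α, β, γ) with its transpose (β, α, γ)
  δ-shift : RowColumnShift (δ ⟨$⟩ʳ_) A
  δ-shift = mkRowColumnShift λ r c → ⟨$⟩ʳ-injective γ (begin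
    γ ⟨$⟩ʳ cell A (δ ⟨$⟩ʳ r) c         ≡⟨ cong (γ ⟨$⟩ʳ_) (symA _ c) ⟩
    γ ⟨$⟩ʳ cell A c (δ ⟨$⟩ʳ r)         ≡⟨ cell≡ isotopism c _ ⟨
    cell B (α ⟨$⟩ʳ c) (β ⟨$⟩ʳ (δ ⟨$⟩ʳ r)) ≡⟨ cong (cell B _) (β∘δ≗α r) ⟩
    cell B (α ⟨$⟩ʳ c) (α ⟨$⟩ʳ r)       ≡⟨ symB _ _ ⟩
    cell B (α ⟨$⟩ʳ r) (α ⟨$⟩ʳ c)       ≡⟨ cong (cell B _) (β∘δ≗α c) ⟨
    cell B (α ⟨$⟩ʳ r) (β ⟨$⟩ʳ (δ ⟨$⟩ʳ c)) ≡⟨ cell≡ isotopism r _ ⟩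
    γ ⟨$⟩ʳ cell A r (δ ⟨$⟩ʳ c)         ∎)

  δ-semiregular : Semiregular δ
  δ-semiregular k _ = RowColumnShift-fixedPoint⇒≗id (RowColumnShift-^ₚ δ-shift k)

  oddPeriod⇒RrsIsotopic : ∃[ i ] IsIdentity (δ ^ₚ suc (i + i)) → RrsIsotopic A B
  oddPeriod⇒RrsIsotopic (i , δ²ⁱ⁺¹≡id) = δ ^ₚ i ∘ₚ α , γ , Isotopism⇒MapsTo rrs
    where
    δⁱ : Fin _ → Fin _
    δⁱ x = δ ^ₚ i ⟨$⟩ʳ x

    rrs : Isotopism (δ ^ₚ i ∘ₚ α) (δ ^ₚ i ∘ₚ α) γ A B
    rrs = mkIsotopism λ r c → begin
      cell B (α ⟨$⟩ʳ (δⁱ r)) (α ⟨$⟩ʳ (δⁱ c))            ≡⟨ cong (cell B _) (β∘δ≗α (δⁱ c)) ⟨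
      cell B (α ⟨$⟩ʳ (δⁱ r)) (β ⟨$⟩ʳ (δ ^ₚ suc i ⟨$⟩ʳ c)) ≡⟨ cell≡ isotopism _ _ ⟩
      γ ⟨$⟩ʳ cell A (δⁱ r) (δ ^ₚ suc i ⟨$⟩ʳ c)           ≡⟨ cong (γ ⟨$⟩ʳ_) (shift (RowColumnShift-^ₚ δ-shift i) r _) ⟩
      γ ⟨$⟩ʳ cell A r (δⁱ (δ ^ₚ suc i ⟨$⟩ʳ c))           ≡⟨ cong (λ x → γ ⟨$⟩ʳ cell A r x) (^ₚ-+ δ i (suc i) c) ⟨
      γ ⟨$⟩ʳ cell A r (δ ^ₚ (i + suc i) ⟨$⟩ʳ c)          ≡⟨ cong (λ m → γ ⟨$⟩ʳ cell A r (δ ^ₚ m ⟨$⟩ʳ c)) (+-suc i i) ⟩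
      γ ⟨$⟩ʳ cell A r (δ ^ₚ suc (i + i) ⟨$⟩ʳ c)          ≡⟨ cong (λ x → γ ⟨$⟩ʳ cell A r x) (δ²ⁱ⁺¹≡id c) ⟩
      γ ⟨$⟩ʳ cell A r c                                  ∎

  involutionPower⇒even×Ω : ∃[ j ] FixedPointFree (δ ^ₚ j) × IsInvolution (δ ^ₚ j) → (2 ∣ _) × Ω A
  involutionPower⇒even×Ω (j , fixedPointFree , involution) =
    fixedPointFreeInvolution⇒even (δ ^ₚ j) fixedPointFree involution ,
    symA , δ ^ₚ j , fixedPointFreeInvolution⇒SemiregularPrime fixedPointFree involution ,
    RowColumnShift⇒IsAutotopism {θ = δ ^ₚ j} (RowColumnShift-^ₚ δ-shift j)

  RrsIsotopic⊎even×Ω : RrsIsotopic A B ⊎ ((2 ∣ _) × Ω A)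
  RrsIsotopic⊎even×Ω = Sum.map oddPeriod⇒RrsIsotopic involutionPower⇒even×Ω (semiregular-odd⊎involution δ-semiregular)

-- The hypothesis says that (α, γ, β) maps the conjugate {(r, s, c) | (r, c, s) ∈ A} onto B.
columnSymbolConjugate⇒RrsIsotopic : Symmetric A → Symmetric B → (α β γ : Permutation′ n) →
  (∀ r c → cell B (α ⟨$⟩ʳ r) (γ ⟨$⟩ʳ cell A r c) ≡ β ⟨$⟩ʳ c) → RrsIsotopic A B
columnSymbolConjugate⇒RrsIsotopic {A = A} {B = B} symA symB α β γ conj =
  α , γ ∘ₚ flip α ∘ₚ β , Isotopism⇒MapsTo rrs
  where
  rrs : Isotopism α α (γ ∘ₚ flip α ∘ₚ β) A B
  rrs = mkIsotopism λ x y → begin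
    cell B (α ⟨$⟩ʳ x) (α ⟨$⟩ʳ y)               ≡⟨ cong (cell B _) (αy≡ x y) ⟩
    cell B (α ⟨$⟩ʳ x) (γ ⟨$⟩ʳ cell A x (w x y)) ≡⟨ conj x (w x y) ⟩
    β ⟨$⟩ʳ w x y                               ∎
    where
    w : Fin _ → Fin _ → Fin _
    w x y = α ⟨$⟩ˡ (γ ⟨$⟩ʳ cell A x y)

    -- Row α w of B has the symbol β x both in column α y and in column γ A(x, w).
    αy≡ : ∀ x y → α ⟨$⟩ʳ y ≡ γ ⟨$⟩ʳ cell A x (w x y)
    αy≡ x y = row-inj B (α ⟨$⟩ʳ w x y) (begin
      cell B (α ⟨$⟩ʳ w x y) (α ⟨$⟩ʳ y)             ≡⟨ symB _ _ ⟩
      cell B (α ⟨$⟩ʳ y) (α ⟨$⟩ʳ w x y)             ≡⟨ cong (cell B _) (trans (inverseʳ α) (cong (γ ⟨$⟩ʳ_) (symA x y))) ⟩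
      cell B (α ⟨$⟩ʳ y) (γ ⟨$⟩ʳ cell A y x)        ≡⟨ conj y x ⟩
      β ⟨$⟩ʳ x                                     ≡⟨ conj (w x y) x ⟨
      cell B (α ⟨$⟩ʳ w x y) (γ ⟨$⟩ʳ cell A (w x y) x) ≡⟨ cong (λ s → cell B (α ⟨$⟩ʳ w x y) (γ ⟨$⟩ʳ s)) (symA _ x) ⟩
      cell B (α ⟨$⟩ʳ w x y) (γ ⟨$⟩ʳ cell A x (w x y)) ∎)

pattern R = zero
pattern C = suc zero
pattern S = suc (suc zero)

-- Which coordinates of a triple (R, C or S) a paratopism sends to the row, column and symbol.
data Arrangement : Fin 3 → Fin 3 → Fin 3 → Set where
  rcs : Arrangement R C S
  crs : Arrangement C R S
  rsc : Arrangement R S C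
  src : Arrangement S R C
  csr : Arrangement C S R
  scr : Arrangement S C R

arrangement : {i j k : Fin 3} → i ≢ j → i ≢ k → j ≢ k → Arrangement i j k
arrangement {R} {R}     i≢j _   _   = contradiction refl i≢j
arrangement {C} {C}     i≢j _   _   = contradiction refl i≢j
arrangement {S} {S}     i≢j _   _   = contradiction refl i≢j
arrangement {R} {C} {R} _   i≢k _   = contradiction refl i≢k
arrangement {R} {C} {C} _   _   j≢k = contradiction refl j≢k
arrangement {R} {C} {S} _   _   _   = rcs
arrangement {R} {S} {R} _   i≢k _   = contradiction refl i≢k
arrangement {R} {S} {C} _   _   _   = rsc
arrangement {R} {S} {S} _   _   j≢k = contradiction refl j≢k
arrangement {C} {R} {R} _   _   j≢k = contradiction refl j≢k
arrangement {C} {R} {C} _   i≢k _   = contradiction refl i≢k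
arrangement {C} {R} {S} _   _   _   = crs
arrangement {C} {S} {R} _   _   _   = csr
arrangement {C} {S} {C} _   i≢k _   = contradiction refl i≢k
arrangement {C} {S} {S} _   _   j≢k = contradiction refl j≢k
arrangement {S} {R} {R} _   _   j≢k = contradiction refl j≢k
arrangement {S} {R} {C} _   _   _   = src
arrangement {S} {R} {S} _   i≢k _   = contradiction refl i≢k
arrangement {S} {C} {R} _   _   _   = scr
arrangement {S} {C} {C} _   _   j≢k = contradiction refl j≢k
arrangement {S} {C} {S} _   i≢k _   = contradiction refl i≢k

paratopism⇒Isotopism⊎RrsIsotopic : (A B : LatinSquare n) → Symmetric A → Symmetric B →
  (σ : Permutation′ 3) (α β γ : Permutation′ n) → MapsTo (permute σ ∘ iso α β γ) A B → Isotopism α β γ A B ⊎ RrsIsotopic A B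
paratopism⇒Isotopism⊎RrsIsotopic A B symA symB σ α β γ maps =
  cases (arrangement (distinct λ ()) (distinct λ ()) (distinct λ ()))
        (λ r c → Equivalence.to (maps (r , c , cell A r c)) refl)
  where
  distinct : {i j : Fin 3} → i ≢ j → σ ⟨$⟩ˡ i ≢ σ ⟨$⟩ˡ j
  distinct i≢j = i≢j ∘ ⟨$⟩ʳ-injective (flip σ)

  image : Fin _ → Fin _ → Triple _
  image r c = iso α β γ (r , c , cell A r c)

  conjugate⇒rrs : (α β γ : Permutation′ _) →
                  (∀ r c → cell B (α ⟨$⟩ʳ r) (γ ⟨$⟩ʳ cell A r c) ≡ β ⟨$⟩ʳ c) → RrsIsotopic A B
  conjugate⇒rrs = columnSymbolConjugate⇒RrsIsotopic {A = A} {B = B} symA symB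

  cases : ∀ {i j k} → Arrangement i j k →
          (∀ r c → cell B (coord (image r c) i) (coord (image r c) j) ≡ coord (image r c) k) →
          Isotopism α β γ A B ⊎ RrsIsotopic A B
  cases rcs maps′ = inj₁ (mkIsotopism maps′)
  cases crs maps′ = inj₁ (mkIsotopism λ r c → trans (symB _ _) (maps′ r c))
  cases rsc maps′ = inj₂ (conjugate⇒rrs α β γ maps′)
  cases src maps′ = inj₂ (conjugate⇒rrs α β γ λ r c → trans (symB _ _) (maps′ r c))
  cases csr maps′ = inj₂ (conjugate⇒rrs β α γ λ r c →
    trans (cong (λ s → cell B (β ⟨$⟩ʳ r) (γ ⟨$⟩ʳ s)) (symA r c)) (maps′ c r))
  cases scr maps′ = inj₂ (conjugate⇒rrs β α γ λ r c →
    trans (cong (λ s → cell B (β ⟨$⟩ʳ r) (γ ⟨$⟩ʳ s)) (symA r c)) (trans (symB _ _) (maps′ c r)))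

lemma4 : (n : ℕ) (A B : LatinSquare n) → Symmetric A → Symmetric B → Paratopic A B →
           Isotopic A B × (¬ RrsIsotopic A B → (2 ∣ n) × Ω A × Ω B)
lemma4 n A B symA symB (σ , α , β , γ , maps) with paratopism⇒Isotopism⊎RrsIsotopic A B symA symB σ α β γ maps
... | inj₂ rrs@(α′ , γ′ , maps′) = (α′ , α′ , γ′ , maps′) , contradiction rrs
... | inj₁ isotopism = (α , β , γ , Isotopism⇒MapsTo isotopism) , even×Ω×Ω
  where
  even×Ω×Ω : ¬ RrsIsotopic A B → (2 ∣ n) × Ω A × Ω B
  even×Ω×Ω ¬rrs with SymmetricIsotopism.RrsIsotopic⊎even×Ω symA symB isotopism
                   | SymmetricIsotopism.RrsIsotopic⊎even×Ω symB symA (Isotopism-flip isotopism)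
  ... | inj₁ rrs        | _             = contradiction rrs ¬rrs
  ... | inj₂ _          | inj₁ rrs      = contradiction (RrsIsotopic-sym {A = B} {B = A} rrs) ¬rrs
  ... | inj₂ (2∣n , ΩA) | inj₂ (_ , ΩB) = 2∣n , ΩA , ΩB
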